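{- Let $\mathcal{T} = \{T_1,\dots,T_t\}$ be a set of unrooted binary phylogenetic trees on leaf set $X$, and let $\tilde x$ be an optimal solution of the LP $$\text{Minimize } \sum_{e \in E(T_1)} x_e \quad \text{s.t. } \sum_{e \in L(Q)} x_e \ge 1 \ \ \forall Q \in \mathcal{Q}, \qquad x_e \ge 0 \ \ \forall e \in E(T_1).$$ Run the following procedure: choose an arbitrary leaf $r$ of $T_1$ as root; set $E=\emptyset$; while there exists an edge $e \in E(T_1)\setminus E$... more precisely, while there exists an edge $e$ satisfying condition (*) below, pick any such edge and add it to $E$; stop when every edge $e \in E(T_1)\setminus E$ satisfies $w(e) < 1/4$. Here condition (*) for an edge $e$ is: $w(e) \ge 1/4$ and $w(f) < 1/4$ for all $f \in D(e)\setminus\{e\}$. Then the final set $E$ satisfies $|E| \le 4 \sum_{e \in E(T_1)} \tilde x_e$.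
   Context: A phylogenetic tree on $X$ is an unrooted tree with all internal vertices of degree 3 and leaves bijectively labelled by $X$. For $Y\subseteq X$, $T[Y]$ is the minimal subtree connecting $Y$, and $T|_Y$ is $T[Y]$ with degree-2 vertices suppressed; trees on the same labels are isomorphic if there is a label-preserving graph isomorphism. A quartet is a 4-element subset of $X$; for $Q = \{a,b,c,d\}$, $ab|cd$ is the tree on $Q$ where $a,b$ share a neighbour, $c,d$ share a neighbour, and these two neighbours are adjacent. If $T_1|_Q \cong ab|cd$, $L(Q)$ is the edge set of $T_1[\{a,b\}] \cup T_1[\{c,d\}]$. $\mathcal{Q}$ is the set of quartets $Q$ such that $T_1|_Q \not\cong T_i|_Q$ for some $2 \le i \le t$. In the procedure, with $T_1$ rooted at leaf $r$, each edge $e$ has endpoints $u_e, v_e$ with $u_e$ on the path from $r$ to $v_e$. For the current set $E$, $D(e)$ is the set of edges $f$ such that $v_e$ lies on the path from $r$ to $v_f$ and the path from $v_e$ to $v_f$ contains no edge of $E$ (so $e \in D(e)$), and $w(e) = \sum_{f \in D(e)} \tilde x_f$; these quantities are recomputed as $E$ grows. -}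

module Defs where

open import Data.Nat using (ℕ; zero; suc)
open import Data.Fin using (Fin; _≟_)
open import Data.Integer using (+_)
open import Data.Rational using (ℚ; 0ℚ; _+_; _/_; _≤_; _<_)
open import Data.Bool using (Bool; true; if_then_else_)
open import Data.List using (List; []; _∷_; _++_; length; filter; foldr; allFin)
open import Data.List.Membership.Propositional using (_∈_; _∉_)
open import Data.List.Relation.Unary.Any using (any?)
open import Data.Product using (Σ; ∃; ∃-syntax; _×_; _,_; proj₁; proj₂)
open import Data.Sum using (_⊎_)
open import Relation.Nullary using (¬_)
open import Relation.Nullary.Decidable using (⌊_⌋; _⊎-dec_)
open import Relation.Binary.PropositionalEquality using (_≡_; _≢_)

Ends : ℕ → ℕ → Set
Ends n k = Fin k → Fin n × Fin n

Joins : ∀ {n k} → Ends n k → Fin k → Fin n → Fin n → Set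
Joins ends i x y = (ends i ≡ (x , y)) ⊎ (ends i ≡ (y , x))

data Path {n k : ℕ} (ends : Ends n k) : Fin n → Fin n → List (Fin n) → List (Fin k) → Set where
  nil  : ∀ u → Path ends u u (u ∷ []) []
  cons : ∀ {x u v vs es} (i : Fin k) → Joins ends i x u → x ∉ vs →
         Path ends u v vs es → Path ends x v (x ∷ vs) (i ∷ es)

-- degree of a vertex (number of incident edges; there are no loops)
deg : ∀ {n k} → Ends n k → Fin n → ℕ
deg {k = k} ends v =
  length (filter (λ i → (v ≟ proj₁ (ends i)) ⊎-dec (v ≟ proj₂ (ends i))) (allFin k))

record PTree (m : ℕ) : Set where
  field
    n k        : ℕ
    ends       : Ends n k
    leaf       : Fin m → Fin n
    noLoop     : ∀ i → proj₁ (ends i) ≢ proj₂ (ends i)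
    noMulti    : ∀ i j x y → Joins ends i x y → Joins ends j x y → i ≡ j
    connected  : ∀ u v → ∃[ vs ] ∃[ es ] Path ends u v vs es
    uniquePath : ∀ {u v vs es vs' es'} → Path ends u v vs es → Path ends u v vs' es' →
                 vs ≡ vs'
    leafInj    : ∀ a b → leaf a ≡ leaf b → a ≡ b
    leafDeg    : ∀ a → deg ends (leaf a) ≡ 1
    internal   : ∀ v → (∀ a → leaf a ≢ v) → deg ends v ≡ 3

open PTree public

Disjoint : ∀ {A : Set} → List A → List A → Set
Disjoint xs ys = ∀ v → v ∈ xs → v ∉ ys

Distinct4 : ∀ {m} → Fin m → Fin m → Fin m → Fin m → Set
Distinct4 a b c d = a ≢ b × a ≢ c × a ≢ d × b ≢ c × b ≢ d × c ≢ d

-- T|_{a,b,c,d} ≅ ab|cd  (path a–b and path c–d in T are vertex-disjoint)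
Displays : ∀ {m} → PTree m → Fin m → Fin m → Fin m → Fin m → Set
Displays T a b c d =
  ∃[ vs₁ ] ∃[ es₁ ] ∃[ vs₂ ] ∃[ es₂ ]
    (Path (ends T) (leaf T a) (leaf T b) vs₁ es₁ ×
     Path (ends T) (leaf T c) (leaf T d) vs₂ es₂ × Disjoint vs₁ vs₂)

sumIf : ∀ {k} → (Fin k → ℚ) → (Fin k → Bool) → ℚ
sumIf {k} x ind = foldr (λ i acc → (if ind i then x i else 0ℚ) + acc) 0ℚ (allFin k)

total : ∀ {k} → (Fin k → ℚ) → ℚ
total x = sumIf x (λ _ → true)

inList : ∀ {k} → List (Fin k) → Fin k → Bool
inList es i = ⌊ any? (i ≟_) es ⌋

-- The LP. T₁ is the first tree, Ts i (i : Fin t) are T₂,…,T_{t+1}.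
-- Constraint for each Q = {a,b,c,d} ∈ 𝒬 with T₁|_Q ≅ ab|cd:
--   Σ_{e ∈ L(Q)} x_e ≥ 1,  L(Q) = E(T₁[{a,b}]) ∪ E(T₁[{c,d}]).

Feasible : ∀ {m t} (T₁ : PTree m) (Ts : Fin t → PTree m) → (Fin (k T₁) → ℚ) → Set
Feasible {m} {t} T₁ Ts x =
  (∀ e → 0ℚ ≤ x e) ×
  (∀ (a b c d : Fin m) → Distinct4 a b c d →
   ∀ {vs₁ es₁ vs₂ es₂} →
   Path (ends T₁) (leaf T₁ a) (leaf T₁ b) vs₁ es₁ →
   Path (ends T₁) (leaf T₁ c) (leaf T₁ d) vs₂ es₂ →
   Disjoint vs₁ vs₂ →
   (∃[ i ] ¬ Displays (Ts i) a b c d) →               -- Q ∈ 𝒬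
   (+ 1 / 1) ≤ sumIf x (inList (es₁ ++ es₂)))

Optimal : ∀ {m t} (T₁ : PTree m) (Ts : Fin t → PTree m) → (Fin (k T₁) → ℚ) → Set
Optimal T₁ Ts x = Feasible T₁ Ts x × (∀ y → Feasible T₁ Ts y → total x ≤ total y)

module Procedure {m : ℕ} (T : PTree m) (x : Fin (k T) → ℚ) (ρ : Fin m) where

  r : Fin (n T)
  r = leaf T ρ

  -- y is the endpoint v_e of e: the other endpoint u_e lies on the path r → y
  IsV : Fin (k T) → Fin (n T) → Set
  IsV e y = ∃[ u ] (Joins (ends T) e u y ×
            ∃[ vs ] ∃[ es ] (Path (ends T) r y vs es × u ∈ vs))

  InD : List (Fin (k T)) → Fin (k T) → Fin (k T) → Set
  InD E e f = ∃[ ve ] ∃[ vf ] (IsV e ve × IsV f vf ×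
              (∃[ vs ] ∃[ es ] (Path (ends T) r vf vs es × ve ∈ vs)) ×
              (∃[ vs ] ∃[ es ] (Path (ends T) ve vf vs es × (∀ g → g ∈ es → g ∉ E))))

  Weight : List (Fin (k T)) → Fin (k T) → ℚ → Set
  Weight E e w = ∃[ ind ] ((∀ f → ind f ≡ true → InD E e f) ×
                           (∀ f → InD E e f → ind f ≡ true) ×
                           w ≡ sumIf x ind)

  quarter : ℚ
  quarter = + 1 / 4

  Cond : List (Fin (k T)) → Fin (k T) → Set
  Cond E e = e ∉ E ×
             (∃[ w ] (Weight E e w × quarter ≤ w)) ×
             (∀ f → InD E e f → f ≢ e → ∀ w → Weight E f w → w < quarter)

  -- sets E reachable by the procedure (listed most recent first)
  data Reach : List (Fin (k T)) → Set where
    start : Reach []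
    step  : ∀ {E e} → Reach E → Cond E e → Reach (e ∷ E)

  Final : List (Fin (k T)) → Set
  Final E = Reach E × (∀ e → e ∉ E → ∀ w → Weight E e w → w < quarter)

-- Each edge e added to E is charged the set D(e) current when e is chosen; by (*) its
-- x̃-weight is at least 1/4. These sets are pairwise disjoint: if g lay in D(e₀) when e₀ was
-- chosen and in D(e) when a later e was chosen, then v_e and v_e₀ both lie on the root path of
-- v_g; v_e = v_e₀ would force e = e₀ ∈ E, and v_e above v_e₀ would put e₀ ∈ E on the E-free
-- path from v_e to v_g. So v_e is below v_e₀, e was in D(e₀), and (*) gave w(e) < 1/4 at that
-- time. Since D(e), and with it w(e), only shrinks as E grows, this contradicts w(e) ≥ 1/4
-- when e was chosen. Summing, |E| / 4 ≤ Σ x̃.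
module Submission where

open import Defs
open import Data.Nat using (ℕ; suc)
open import Data.Fin using (Fin)
open import Data.Integer using (+_)
open import Data.Rational using (ℚ; _/_; _*_; _≤_; _+_; 0ℚ; 1ℚ; _<_)
open import Data.List using (List; length; []; _∷_; _++_; foldr; allFin; [_])
import Data.Nat.Properties as ℕ
import Data.Integer as ℤ
import Data.Integer.Properties as ℤ
open import Data.Nat.Coprimality using (1-coprimeTo) renaming (sym to coprime-sym)
import Data.Fin as Fin
import Data.Fin.Properties as Fin
open import Data.Rational.Properties
  using ( normalize-coprime; ≤-refl; ≤-reflexive; ≤-trans; ≤-<-trans; <-irrefl; +-mono-≤
        ; +-identityˡ; +-identityʳ; *-monoˡ-≤-nonNeg; *-distribˡ-+; +-0-commutativeMonoid
        ; module ≤-Reasoning)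
open import Algebra.Bundles using (CommutativeMonoid)
open import Algebra.Properties.CommutativeSemigroup
  (CommutativeMonoid.commutativeSemigroup +-0-commutativeMonoid) using (interchange)
open import Data.Bool using (Bool; true; false; _∨_; if_then_else_)
open import Data.Bool.Properties using (T-≡)
open import Data.List.Properties
  using (++-assoc; ++-cancelˡ; ++-conicalˡ; ++-conicalʳ; ∷ʳ-injectiveʳ; ∷-injectiveʳ)
open import Data.List.Membership.Propositional using (_∈_; _∉_)
open import Data.List.Membership.Propositional.Properties
  using (∈-∃++; ∈-++⁻; ∈-++⁺ˡ; ∈-++⁺ʳ)
import Data.List.Membership.DecPropositional as DecMembership
open import Data.List.Relation.Binary.Subset.Propositional using (_⊆_)
open import Data.List.Relation.Binary.Subset.Propositional.Properties
  using (++⁺ʳ; xs⊆xs++ys; xs⊆x∷xs)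
open import Data.List.Relation.Unary.Any using (here; there)
import Data.List.Relation.Unary.All as All
open import Data.Product using (∃-syntax; _×_; _,_; proj₁; proj₂)
open import Data.Product.Properties using (≡-dec)
open import Data.Sum using (_⊎_; inj₁; inj₂; reduce)
open import Data.Empty using (⊥; ⊥-elim)
open import Function using (_∘_; Equivalence)
open import Relation.Nullary using (Dec)
open import Relation.Nullary.Decidable
  using (isYes; _⊎-dec_; _×-dec_; ¬?; map′; toWitness; fromWitness)
open import Relation.Binary.PropositionalEquality hiding ([_])

/1-suc : ∀ n → + suc n / 1 ≡ + n / 1 + 1ℚ
/1-suc n rewrite normalize-coprime (coprime-sym (1-coprimeTo n)) =
  cong (_/ 1) (trans (cong +_ (ℕ.+-comm 1 n))
                     (cong (ℤ._+ + 1) (sym (ℤ.*-identityʳ (+ n)))))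

last-∈-suffix : ∀ {A : Set} (xs ys zs : List A) {z} →
                xs ++ ys ≡ zs ++ [ z ] → ys ≡ [] ⊎ z ∈ ys
last-∈-suffix []       ys zs       eq = inj₂ (subst (_ ∈_) (sym eq) (∈-++⁺ʳ zs (here refl)))
last-∈-suffix (x ∷ xs) ys []       eq = inj₁ (++-conicalʳ xs ys (∷-injectiveʳ eq))
last-∈-suffix (x ∷ xs) ys (_ ∷ zs) eq = last-∈-suffix xs ys zs (∷-injectiveʳ eq)

prefix-⊆ : ∀ {A : Set} (p : List A) {w s} → p ++ [ w ] ⊆ p ++ w ∷ s
prefix-⊆ p {w} {s} = ++⁺ʳ p (xs⊆xs++ys [ w ] s)

module _ {A : Set} (x : A → ℚ) where

  sumOver : (A → Bool) → List A → ℚ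
  sumOver ind = foldr (λ i acc → (if ind i then x i else 0ℚ) + acc) 0ℚ

  sumOver-false : ∀ l → sumOver (λ _ → false) l ≡ 0ℚ
  sumOver-false []      = refl
  sumOver-false (_ ∷ l) = trans (+-identityˡ _) (sumOver-false l)

  sumOver-mono : (∀ i → 0ℚ ≤ x i) → ∀ {a b} → (∀ i → a i ≡ true → b i ≡ true) →
                 ∀ l → sumOver a l ≤ sumOver b l
  sumOver-mono x≥0 a⇒b []            = ≤-refl
  sumOver-mono x≥0 {a} {b} a⇒b (i ∷ l) =
    +-mono-≤ (term (a i) (b i) (a⇒b i)) (sumOver-mono x≥0 a⇒b l)
    where
    term : ∀ p q → (p ≡ true → q ≡ true) → (if p then x i else 0ℚ) ≤ (if q then x i else 0ℚ)
    term true  true  _   = ≤-refl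
    term true  false p⇒q with () ← p⇒q refl
    term false true  _   = x≥0 i
    term false false _   = ≤-refl

  sumOver-∨ : ∀ {a b} → (∀ i → a i ≡ true → b i ≡ true → ⊥) →
              ∀ l → sumOver (λ i → a i ∨ b i) l ≡ sumOver a l + sumOver b l
  sumOver-∨ disj []            = sym (+-identityˡ 0ℚ)
  sumOver-∨ {a} {b} disj (i ∷ l) =
    trans (cong₂ _+_ (term (a i) (b i) (disj i)) (sumOver-∨ disj l))
          (interchange (if a i then x i else 0ℚ) (if b i then x i else 0ℚ)
                       (sumOver a l) (sumOver b l))
    where
    term : ∀ p q → (p ≡ true → q ≡ true → ⊥) →
           (if p ∨ q then x i else 0ℚ) ≡ (if p then x i else 0ℚ) + (if q then x i else 0ℚ)
    term true  true  both = ⊥-elim (both refl refl)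
    term true  false _    = sym (+-identityʳ (x i))
    term false true  _    = sym (+-identityˡ (x i))
    term false false _    = sym (+-identityˡ 0ℚ)

module _ {n k : ℕ} {ends : Ends n k} where

  Path-start-unique : ∀ {u u' v v' vs es es'} →
                      Path ends u v vs es → Path ends u' v' vs es' → u ≡ u'
  Path-start-unique (nil _)        (nil _)        = refl
  Path-start-unique (nil _)        (cons _ _ _ _) = refl
  Path-start-unique (cons _ _ _ _) (nil _)        = refl
  Path-start-unique (cons _ _ _ _) (cons _ _ _ _) = refl

  Path-empty : ∀ {u v vs} → Path ends u v vs [] → u ≡ v
  Path-empty (nil _) = refl

  Path-split : ∀ {u v vs es} → Path ends u v vs es → ∀ p {w s} → vs ≡ p ++ w ∷ s →
               ∃[ es₁ ] ∃[ es₂ ] (Path ends u w (p ++ [ w ]) es₁ × Path ends w v (w ∷ s) es₂ ×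
                                  es ≡ es₁ ++ es₂)
  Path-split (nil u)          []            refl = [] , [] , nil u , nil u , refl
  Path-split (nil u)          (_ ∷ [])      ()
  Path-split (nil u)          (_ ∷ _ ∷ _)   ()
  Path-split (cons i J x∉ P)  []            refl = [] , _ , nil _ , cons i J x∉ P , refl
  Path-split (cons i J x∉ P)  (_ ∷ p)       refl with Path-split P p refl
  ... | es₁ , es₂ , P₁ , P₂ , refl =
    i ∷ es₁ , es₂ , cons i J (x∉ ∘ prefix-⊆ p) P₁ , P₂ , refl

module _ {m : ℕ} (T : PTree m) where

  Path-vertices-determine-edges : ∀ {u u' v vs es es'} →
    Path (ends T) u v vs es → Path (ends T) u' v vs es' → es ≡ es'
  Path-vertices-determine-edges (nil _)        (nil _)          = refl
  Path-vertices-determine-edges (nil _)        (cons _ _ _ ())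
  Path-vertices-determine-edges (cons _ _ _ ()) (nil _)
  Path-vertices-determine-edges (cons i J _ P) (cons j J' _ P') with Path-start-unique P P'
  ... | refl = cong₂ _∷_ (noMulti T i j _ _ J J') (Path-vertices-determine-edges P P')

  Path-edges-unique : ∀ {u v vs es vs' es'} →
                      Path (ends T) u v vs es → Path (ends T) u v vs' es' → es ≡ es'
  Path-edges-unique P P' with uniquePath T P P'
  ... | refl = Path-vertices-determine-edges P P'

  Path-edges-split : ∀ {u v a vs es vs₁ es₁ vs₂ es₂} → Path (ends T) u v vs es → a ∈ vs →
                     Path (ends T) u a vs₁ es₁ → Path (ends T) a v vs₂ es₂ → es ≡ es₁ ++ es₂
  Path-edges-split P a∈ P₁ P₂ with ∈-∃++ a∈
  ... | p , s , eq with Path-split P p eq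
  ... | _ , _ , Q₁ , Q₂ , refl =
    cong₂ _++_ (Path-edges-unique Q₁ P₁) (Path-edges-unique Q₂ P₂)

  Joins-distinct : ∀ {e u y} → Joins (ends T) e u y → u ≢ y
  Joins-distinct {e} J refl with ends-loop ← reduce J =
    noLoop T e (trans (cong proj₁ ends-loop) (sym (cong proj₂ ends-loop)))

  Joins-path : ∀ {e u y} → Joins (ends T) e u y → Path (ends T) u y (u ∷ y ∷ []) (e ∷ [])
  Joins-path J = cons _ J (λ { (here u≡y) → Joins-distinct J u≡y ; (there ()) }) (nil _)

  Joins-same-edge : ∀ {e u y u' y'} → Joins (ends T) e u y → Joins (ends T) e u' y' →
                    y ≡ y' ⊎ (u ≡ y' × u' ≡ y)
  Joins-same-edge (inj₁ p) (inj₁ q) = inj₁ (cong proj₂ (trans (sym p) q))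
  Joins-same-edge (inj₁ p) (inj₂ q) =
    inj₂ (cong proj₁ (trans (sym p) q) , cong proj₂ (trans (sym q) p))
  Joins-same-edge (inj₂ p) (inj₁ q) =
    inj₂ (cong proj₂ (trans (sym p) q) , cong proj₁ (trans (sym q) p))
  Joins-same-edge (inj₂ p) (inj₂ q) = inj₁ (cong proj₁ (trans (sym p) q))

  Path-dec : (P : List (Fin (n T)) → List (Fin (k T)) → Set) → (∀ vs es → Dec (P vs es)) →
             ∀ u v → Dec (∃[ vs ] ∃[ es ] (Path (ends T) u v vs es × P vs es))
  Path-dec P P? u v with connected T u v
  ... | vs , es , Q = map′ (λ p → vs , es , Q , p) on-Q (P? vs es)
    where
    on-Q : ∃[ vs' ] ∃[ es' ] (Path (ends T) u v vs' es' × P vs' es') → P vs es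
    on-Q (_ , _ , Q' , p) = subst₂ P (sym (uniquePath T Q Q')) (sym (Path-edges-unique Q Q')) p

module Rooted {m : ℕ} (T : PTree m) (x : Fin (k T) → ℚ) (ρ : Fin m) where
  open Procedure T x ρ

  private
    V  = Fin (n T)
    Ed = Fin (k T)
    open DecMembership (Fin._≟_ {n T}) using () renaming (_∈?_ to _∈V?_)
    open DecMembership (Fin._≟_ {k T}) using () renaming (_∈?_ to _∈E?_)

  -- IsV e y unfolds to  ∃ u (Joins e u y × u ≼ y),  and InD E e f asks  v_e ≼ v_f.
  infix 4 _≼_
  _≼_ : V → V → Set
  a ≼ y = ∃[ vs ] ∃[ es ] (Path (ends T) r y vs es × a ∈ vs)

  ≼-root-path : ∀ {a y vs es} → a ≼ y → Path (ends T) r y vs es → a ∈ vs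
  ≼-root-path (_ , _ , P , a∈) P' = subst (_ ∈_) (uniquePath T P P') a∈

  ≼-trans : ∀ {a b y} → a ≼ b → b ≼ y → a ≼ y
  ≼-trans a≼b (vs , es , P , b∈) with ∈-∃++ b∈
  ... | p , s , refl with Path-split P p refl
  ... | _ , _ , Pb , _ , _ = _ , _ , P , prefix-⊆ p (≼-root-path a≼b Pb)

  ≼-total : ∀ {a b y} → a ≼ y → b ≼ y → a ≼ b ⊎ b ≼ a
  ≼-total {a} {b} a≼y (vs , es , P , b∈) with ∈-∃++ b∈
  ... | p , s , refl with Path-split P p refl | ∈-++⁻ p (≼-root-path a≼y P)
  ... | _ , _ , Pb , _ , _ | inj₁ a∈p         = inj₁ (_ , _ , Pb , ∈-++⁺ˡ a∈p)
  ... | _ , _ , Pb , _ , _ | inj₂ (here refl) = inj₁ (_ , _ , Pb , ∈-++⁺ʳ p (here refl))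
  ... | _ | inj₂ (there a∈s) with ∈-∃++ a∈s
  ... | s₁ , s₂ , refl with Path-split P (p ++ b ∷ s₁) (sym (++-assoc p (b ∷ s₁) (a ∷ s₂)))
  ... | _ , _ , Pa , _ , _ = inj₂ (_ , _ , Pa , ∈-++⁺ˡ (∈-++⁺ʳ p (here refl)))

  ≼-root-edges : ∀ {a y vs₁ es₁ vs₂ es₂ vs es} → a ≼ y →
                 Path (ends T) r a vs₁ es₁ → Path (ends T) a y vs₂ es₂ →
                 Path (ends T) r y vs es → es ≡ es₁ ++ es₂
  ≼-root-edges a≼y P₁ P₂ P = Path-edges-split T P (≼-root-path a≼y P) P₁ P₂

  ≼-path-edges : ∀ {a b y vs₁ es₁ vs₂ es₂ vs es} → a ≼ b → b ≼ y →
                 Path (ends T) a b vs₁ es₁ → Path (ends T) b y vs₂ es₂ →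
                 Path (ends T) a y vs es → es ≡ es₁ ++ es₂
  ≼-path-edges {a} {b} {y} {es₁ = es₁} {es₂ = es₂} {es = es} a≼b b≼y P₁ P₂ P
    with connected T r a | connected T r b | connected T r y
  ... | _ , esa , Ra | _ , esb , Rb | _ , esy , Ry = ++-cancelˡ esa es (es₁ ++ es₂) (begin
    esa ++ es            ≡⟨ sym (≼-root-edges (≼-trans a≼b b≼y) Ra P Ry) ⟩
    esy                  ≡⟨ ≼-root-edges b≼y Rb P₂ Ry ⟩
    esb ++ es₂           ≡⟨ cong (_++ es₂) (≼-root-edges a≼b Ra P₁ Rb) ⟩
    (esa ++ es₁) ++ es₂  ≡⟨ ++-assoc esa es₁ es₂ ⟩
    esa ++ es₁ ++ es₂    ∎)
    where open ≡-Reasoning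

  ≼-antisym : ∀ {a b} → a ≼ b → b ≼ a → a ≡ b
  ≼-antisym {a} {b} a≼b b≼a with connected T a b | connected T b a
  ... | _ , es₁ , P₁ | _ , es₂ , P₂ = Path-empty (subst (Path _ a b _) es₁≡[] P₁)
    where
    es₁≡[] : es₁ ≡ []
    es₁≡[] = ++-conicalˡ es₁ es₂ (sym (≼-path-edges a≼b b≼a P₁ P₂ (nil a)))

  IsV-last-edge : ∀ {e y vs es} → IsV e y → Path (ends T) r y vs es →
                  ∃[ A ] es ≡ A ++ [ e ]
  IsV-last-edge (u , J , u≼y) P with connected T r u
  ... | _ , A , Ru = A , ≼-root-edges u≼y Ru (Joins-path T J) P

  IsV-edge-unique : ∀ {e e' y} → IsV e y → IsV e' y → e ≡ e'
  IsV-edge-unique {y = y} V V' with connected T r y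
  ... | _ , _ , P with IsV-last-edge V P | IsV-last-edge V' P
  ... | A , eq | A' , eq' = ∷ʳ-injectiveʳ A A' (trans (sym eq) eq')

  IsV-vertex-unique : ∀ {f y y'} → IsV f y → IsV f y' → y ≡ y'
  IsV-vertex-unique (_ , J , u≼y) (_ , J' , u'≼y') with Joins-same-edge T J J'
  ... | inj₁ y≡y'          = y≡y'
  ... | inj₂ (refl , refl) = ≼-antisym u'≼y' u≼y

  IsV-edge-below : ∀ {e a y vs es} → IsV e y → a ≼ y → a ≢ y →
                   Path (ends T) a y vs es → e ∈ es
  IsV-edge-below {a = a} {y} {es = es} V a≼y a≢y P with connected T r a | connected T r y
  ... | _ , esa , Ra | _ , _ , Ry with IsV-last-edge V Ry
  ... | A , eq with last-∈-suffix esa es A (trans (sym (≼-root-edges a≼y Ra P Ry)) eq)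
  ... | inj₁ refl = ⊥-elim (a≢y (Path-empty P))
  ... | inj₂ e∈es = e∈es

  D-nested : ∀ {E₀ E e₀ e g} → e₀ ∈ E → e ∉ E → InD E₀ e₀ g → InD E e g → InD E₀ e₀ e
  D-nested {E = E} {e₀} {e} e₀∈E e∉E
           (v₀ , vg , V₀ , Vg  , v₀≼vg , (_ , es₀ , P₀ , P₀-avoids))
           (v  , _  , V  , Vg' , v≼vg  , (_ , es , P  , P-avoids))
    with IsV-vertex-unique Vg' Vg
  ... | refl with ≼-total v₀≼vg v≼vg | connected T v₀ v | connected T v v₀
  ... | inj₁ v₀≼v | _ , es₀₁ , P₀₁ | _ =
    v₀ , v , V₀ , V , v₀≼v ,
    (_ , _ , P₀₁ , λ h h∈ → P₀-avoids h (⊆-P₀ (∈-++⁺ˡ h∈)))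
    where
    ⊆-P₀ : es₀₁ ++ es ⊆ es₀
    ⊆-P₀ = subst (_ ∈_) (sym (≼-path-edges v₀≼v v≼vg P₀₁ P P₀))
  ... | inj₂ v≼v₀ | _ | _ , _ , P₁₀ = ⊥-elim (P-avoids e₀ e₀∈P e₀∈E)
    where
    v≢v₀ : v ≢ v₀
    v≢v₀ refl = e∉E (subst (_∈ E) (IsV-edge-unique V₀ V) e₀∈E)
    e₀∈P : e₀ ∈ es
    e₀∈P = subst (e₀ ∈_) (sym (≼-path-edges v≼v₀ v₀≼vg P₁₀ P₀ P))
                 (∈-++⁺ˡ (IsV-edge-below V₀ v≼v₀ v≢v₀ P₁₀))

  ≼-dec : ∀ a y → Dec (a ≼ y)
  ≼-dec a = Path-dec T (λ vs _ → a ∈ vs) (λ vs _ → a ∈V? vs) r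

  IsV-dec : ∀ e y → Dec (IsV e y)
  IsV-dec e y = Fin.any? λ u → Joins-dec u ×-dec ≼-dec u y
    where
    Joins-dec : ∀ u → Dec (Joins (ends T) e u y)
    Joins-dec u = ≡-dec Fin._≟_ Fin._≟_ (ends T e) (u , y)
             ⊎-dec ≡-dec Fin._≟_ Fin._≟_ (ends T e) (y , u)

  -- The minimality clause of (*) only bounds weights that exist, so applying it to D(e)
  -- requires a computable indicator of D(e).
  InD-dec : ∀ E e f → Dec (InD E e f)
  InD-dec E e f = Fin.any? λ ve → Fin.any? λ vf →
    IsV-dec e ve ×-dec IsV-dec f vf ×-dec ≼-dec ve vf ×-dec
    Path-dec T (λ _ es → Avoids es) (λ _ → Avoids-dec) ve vf
    where
    Avoids : List Ed → Set
    Avoids es = ∀ g → g ∈ es → g ∉ E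
    Avoids-dec : ∀ es → Dec (Avoids es)
    Avoids-dec es = map′ (λ all g → All.lookup all) (λ avoids → All.tabulate (avoids _))
                         (All.all? (λ g → ¬? (g ∈E? E)) es)

  InDᵇ : List Ed → Ed → Ed → Bool
  InDᵇ E e f = isYes (InD-dec E e f)

  InDᵇ-Weight : ∀ E e → Weight E e (sumIf x (InDᵇ E e))
  InDᵇ-Weight E e = InDᵇ E e
                  , (λ f h → toWitness {a? = InD-dec E e f} (Equivalence.from T-≡ h))
                  , (λ f f∈D → Equivalence.to T-≡ (fromWitness f∈D))
                  , refl

  InD-antitone : ∀ {E₀ E e g} → E₀ ⊆ E → InD E e g → InD E₀ e g
  InD-antitone E₀⊆E (ve , vf , Ve , Vf , ve≼vf , (vs , es , P , avoids)) =
    ve , vf , Ve , Vf , ve≼vf , (vs , es , P , λ h h∈ h∈E₀ → avoids h h∈ (E₀⊆E h∈E₀))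

  Weight-antitone : (∀ i → 0ℚ ≤ x i) → ∀ {E₀ E e w₀ w} → E₀ ⊆ E →
                    Weight E₀ e w₀ → Weight E e w → w ≤ w₀
  Weight-antitone x≥0 E₀⊆E (_ , _ , complete₀ , refl) (_ , sound , _ , refl) =
    sumOver-mono x x≥0 (λ f h → complete₀ f (InD-antitone E₀⊆E (sound f h))) (allFin _)

  D-disjoint : (∀ i → 0ℚ ≤ x i) → ∀ {E₀ E e₀ e g} → Cond E₀ e₀ → Cond E e → e₀ ∈ E → E₀ ⊆ E →
               InD E₀ e₀ g → InD E e g → ⊥
  D-disjoint x≥0 {E₀} {e = e} (_ , _ , D₀-light) (e∉E , (w , W , ¼≤w) , _) e₀∈E E₀⊆E g∈D₀ g∈D =
    <-irrefl refl (≤-<-trans (≤-trans ¼≤w heavier-before) light-before)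
    where
    heavier-before : w ≤ sumIf x (InDᵇ E₀ e)
    heavier-before = Weight-antitone x≥0 E₀⊆E (InDᵇ-Weight E₀ e) W
    light-before : sumIf x (InDᵇ E₀ e) < quarter
    light-before =
      D₀-light e (D-nested e₀∈E e∉E g∈D₀ g∈D) (λ { refl → e∉E e₀∈E }) _ (InDᵇ-Weight E₀ e)

  InEarlierD : List Ed → Ed → Set
  InEarlierD E g = ∃[ E₀ ] ∃[ e₀ ] (Cond E₀ e₀ × e₀ ∈ E × E₀ ⊆ E × InD E₀ e₀ g)

  record Charging (E : List Ed) : Set where
    field
      charged            : Ed → Bool
      length≤4*charged   : + length E / 1 ≤ + 4 / 1 * sumIf x charged
      charged⇒InEarlierD : ∀ g → charged g ≡ true → InEarlierD E g

  charging : (∀ i → 0ℚ ≤ x i) → ∀ {E} → Reach E → Charging E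
  charging x≥0 start = record
    { charged            = λ _ → false
    ; length≤4*charged   = ≤-reflexive (cong (+ 4 / 1 *_) (sym (sumOver-false x (allFin _))))
    ; charged⇒InEarlierD = λ _ ()
    }
  charging x≥0 {e ∷ E} (step R cond@(_ , (w , (ind , sound , _ , refl) , ¼≤w) , _)) = record
    { charged            = λ g → charged g ∨ ind g
    ; length≤4*charged   = counted
    ; charged⇒InEarlierD = earlier
    }
    where
    open Charging (charging x≥0 R)

    disjoint : ∀ g → charged g ≡ true → ind g ≡ true → ⊥
    disjoint g c i with charged⇒InEarlierD g c
    ... | _ , _ , cond₀ , e₀∈E , E₀⊆E , g∈D₀ =
      D-disjoint x≥0 cond₀ cond e₀∈E E₀⊆E g∈D₀ (sound g i)

    counted : + suc (length E) / 1 ≤ + 4 / 1 * sumIf x (λ g → charged g ∨ ind g)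
    counted = begin
      + suc (length E) / 1
        ≡⟨ /1-suc (length E) ⟩
      + length E / 1 + 1ℚ
        ≤⟨ +-mono-≤ length≤4*charged (*-monoˡ-≤-nonNeg (+ 4 / 1) ¼≤w) ⟩
      + 4 / 1 * sumIf x charged + + 4 / 1 * w
        ≡⟨ *-distribˡ-+ (+ 4 / 1) (sumIf x charged) w ⟨
      + 4 / 1 * (sumIf x charged + w)
        ≡⟨ cong (+ 4 / 1 *_) (sumOver-∨ x disjoint (allFin _)) ⟨
      + 4 / 1 * sumIf x (λ g → charged g ∨ ind g)
        ∎
      where open ≤-Reasoning

    earlier : ∀ g → charged g ∨ ind g ≡ true → InEarlierD (e ∷ E) g
    earlier g h with charged g in c
    ... | true with E₀ , e₀ , cond₀ , e₀∈E , E₀⊆E , g∈D₀ ← charged⇒InEarlierD g c =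
      E₀ , e₀ , cond₀ , there e₀∈E , xs⊆x∷xs E e ∘ E₀⊆E , g∈D₀
    ... | false = E , e , cond , here refl , xs⊆x∷xs E e , sound g h

lemma4 : ∀ {m t : ℕ} (T₁ : PTree m) (Ts : Fin t → PTree m) (x̃ : Fin (k T₁) → ℚ) →
         Optimal T₁ Ts x̃ → (ρ : Fin m) (E : List (Fin (k T₁))) →
         Procedure.Final T₁ x̃ ρ E →
         (+ length E / 1) ≤ (+ 4 / 1) * total x̃
lemma4 T₁ Ts x̃ ((x̃≥0 , _) , _) ρ E (reach , _) =
  ≤-trans length≤4*charged (*-monoˡ-≤-nonNeg (+ 4 / 1) charged≤total)
  where
  open Rooted T₁ x̃ ρ
  open Charging (charging x̃≥0 reach)

  charged≤total : sumIf x̃ charged ≤ total x̃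
  charged≤total = sumOver-mono x̃ x̃≥0 {charged} (λ _ _ → refl) (allFin _)
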